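{- Let $r\geq4$, let $G$ be an extraspecial $2$-group of order $2^{2r+1}$ with centre $Z$, suppose $\{Zg_1,\ldots,Zg_{2r}\}$ ($g_i\in G$) is a symmetric basis of $G/Z$ with respect to the quadratic form $Q(Zx)=x^2$, let $S=\{g_1,\ldots,g_{2r}\}$, $\Gamma=\mathrm{Cay}(G,S)$ and $A=\mathrm{Aut}(\Gamma)$. Then the subgroup $A_{\mathbf 1}^{[1]}$ of automorphisms of $\Gamma$ fixing the vertex $\mathbf 1$ and each vertex of its neighbourhood $N(\mathbf 1)=S$ is trivial.
   Context: An extraspecial $2$-group of order $2^{2r+1}$ is a $2$-group $G$ with $|Z(G)|=2$ and $G/Z(G)\cong\mathbb{Z}_2^{2r}$. Identifying $Z$ with $\mathbb{F}_2$, $Q(Zx)=x^2$ is a quadratic form on $G/Z$ with associated bilinear form $B(Zx,Zy)=[x,y]$. A basis is symmetric if $Q(v_i)=0$ for all $i$ and $B(v_i,v_j)=1$ for $i<j$. $\mathrm{Cay}(G,S)$ has vertex set $G$ and edges $\{x,sx\}$, $x\in G$, $s\in S$. -}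

module Defs where

open import Level using (Level; _⊔_)
open import Data.Nat using (ℕ; zero; suc; _+_; _*_; _^_)
open import Data.Fin using (Fin; zero; suc; _<_)
open import Data.Bool using (Bool; true; false; if_then_else_)
open import Data.Product using (Σ; ∃; _×_; _,_)
open import Data.Sum using (_⊎_)
open import Relation.Nullary using (¬_)
open import Relation.Binary.PropositionalEquality as ≡ using (_≡_)
open import Function.Bundles using (Bijection; _⇔_)
open import Algebra.Bundles using (Group)

module _ {c ℓ : Level} (G : Group c ℓ) where
  open Group G renaming (Carrier to A)

  IsCentral : A → Set (c ⊔ ℓ)
  IsCentral z = ∀ x → z ∙ x ≈ x ∙ z

  comm : A → A → A
  comm x y = ((x ⁻¹ ∙ y ⁻¹) ∙ x) ∙ y

  -- G is an extraspecial 2-group of order 2^(2r+1):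
  -- |G| = 2^(2r+1), |Z(G)| = 2, and G/Z(G) is elementary abelian
  -- (of order 2^(2r), i.e. ≅ Z_2^(2r)): squares and commutators lie in Z(G).
  record IsExtraspecial (r : ℕ) : Set (c ⊔ ℓ) where
    field
      order        : Bijection setoid (≡.setoid (Fin (2 ^ (2 * r + 1))))
      z₀           : A
      z₀-central   : IsCentral z₀
      z₀≉ε         : ¬ (z₀ ≈ ε)
      centre⊆      : ∀ z → IsCentral z → (z ≈ ε) ⊎ (z ≈ z₀)
      sq-central   : ∀ x → IsCentral (x ∙ x)
      comm-central : ∀ x y → IsCentral (comm x y)

  -- ordered product of the g_i with T i ≡ true (i.e. a representative of
  -- the F₂-linear combination Σ_{i ∈ T} Z g_i in G/Z)
  prod : {n : ℕ} → (Fin n → A) → (Fin n → Bool) → A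
  prod {zero}  g T = ε
  prod {suc n} g T = (if T zero then g zero else ε) ∙ prod (λ i → g (suc i)) (λ i → T (suc i))

  record IsBasisModCentre {n : ℕ} (g : Fin n → A) : Set (c ⊔ ℓ) where
    field
      independent : ∀ T → IsCentral (prod g T) → ∀ i → T i ≡ false
      spanning    : ∀ x → Σ (Fin n → Bool) λ T → Σ A λ z →
                      IsCentral z × (x ≈ z ∙ prod g T)

  -- symmetric basis: basis with Q(Z g_i) = g_i² = 0 (the identity of Z ≅ F₂)
  -- and B(Z g_i, Z g_j) = [g_i, g_j] = 1 (the non-identity element of Z) for i < j
  record IsSymmetricBasis {n : ℕ} (g : Fin n → A) : Set (c ⊔ ℓ) where
    field
      basis : IsBasisModCentre g
      Q-zero : ∀ i → g i ∙ g i ≈ ε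
      B-one  : ∀ i j → i < j → ¬ (comm (g i) (g j) ≈ ε)

  CayAdj : {n : ℕ} → (Fin n → A) → A → A → Set ℓ
  CayAdj g x y = Σ (Fin _) λ i → (y ≈ g i ∙ x) ⊎ (x ≈ g i ∙ y)

  record CayAut {n : ℕ} (g : Fin n → A) : Set (c ⊔ ℓ) where
    field
      perm     : Bijection setoid setoid
    open Bijection perm public using (to)
    field
      adj-pres : ∀ x y → CayAdj g x y ⇔ CayAdj g (to x) (to y)

-- The generators g i are involutions which pairwise anticommute up to the central involution z₀,
-- and since they form a basis of G/Z, every relation among them uses each letter an even number
-- of times. Let f fix 1 and every g i. The image of g k g j is a neighbour g l g j of g j. If
-- l ∉ {j, k}, then for each a ∉ {j, k} the walk g k, g a g k, g j g a g k, g a g j g a g k = g k g j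
-- forces f (g a g k) ∈ {g l g k, g j g k}: otherwise the image walk yields a relation of length six
-- with a letter occurring once. As 2r ≥ 5 there are three such a, contradicting injectivity; so f
-- fixes every vertex at distance two from 1. Conjugating f by right translations, which are
-- automorphisms of Γ, propagates this along words in the g i, and these words exhaust G.

module Submission where

open import Defs
open import Level using (Level; _⊔_)
open import Data.Nat using (ℕ; zero; suc; _+_; _≤_; _*_; s≤s; z≤n)
open import Data.Nat.Properties using (≤-trans; *-monoʳ-≤)
open import Data.Fin using (Fin; zero; suc; _<_; punchIn; punchOut; inject≤)
open import Data.Fin.Properties
  using (_≟_; punchIn-injective; punchInᵢ≢i; punchIn-punchOut; inject≤-injective; <-cmp)
open import Data.Bool using (Bool; true; false; _xor_)
open import Data.List using (List; []; _∷_; _++_; map; foldr)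
open import Data.List.Properties using (foldr-map)
open import Data.Product using (Σ-syntax; ∃₂; ∃-syntax; _×_; _,_; proj₁; proj₂)
open import Data.Sum using (_⊎_; inj₁; inj₂)
open import Function using (_∘_)
open import Function.Bundles using (Bijection; Equivalence)
open import Relation.Binary using (Rel; Preorder; tri<; tri≈; tri>)
open import Relation.Nullary using (¬_; Dec; yes; no; does; contradiction)
open import Relation.Nullary.Decidable using (dec-true; dec-false)
open import Relation.Binary.PropositionalEquality as ≡ using (_≡_; _≢_; ≢-sym)
open import Algebra.Bundles using (Group)

toggle : ∀ {n} → Fin n → (Fin n → Bool) → Fin n → Bool
toggle i T m = does (i ≟ m) xor T m

parity : ∀ {n} → List (Fin n) → Fin n → Bool
parity []      = λ _ → false
parity (i ∷ w) = toggle i (parity w)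

hexagon-odd : ∀ {n} {j k l b c d : Fin n} → j ≢ k → l ≢ j → l ≢ k → b ≢ j → b ≢ k → b ≢ l →
              ∃[ x ] parity (k ∷ b ∷ c ∷ d ∷ l ∷ j ∷ []) x ≡ true
hexagon-odd {j = j} {k} {l} {b} {c} {d} j≢k l≢j l≢k b≢j b≢k b≢l =
  choose (c ≟ k) (d ≟ k) (c ≟ l) (d ≟ l)
  where
  odd-k : c ≢ k → d ≢ k → parity (k ∷ b ∷ c ∷ d ∷ l ∷ j ∷ []) k ≡ true
  odd-k c≢k d≢k
    rewrite dec-true (k ≟ k) ≡.refl | dec-false (b ≟ k) b≢k | dec-false (c ≟ k) c≢k
          | dec-false (d ≟ k) d≢k | dec-false (l ≟ k) l≢k | dec-false (j ≟ k) j≢k = ≡.refl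
  odd-l : c ≢ l → d ≢ l → parity (k ∷ b ∷ c ∷ d ∷ l ∷ j ∷ []) l ≡ true
  odd-l c≢l d≢l
    rewrite dec-false (k ≟ l) (≢-sym l≢k) | dec-false (b ≟ l) b≢l | dec-false (c ≟ l) c≢l
          | dec-false (d ≟ l) d≢l | dec-true (l ≟ l) ≡.refl | dec-false (j ≟ l) (≢-sym l≢j) = ≡.refl
  odd-j : c ≢ j → d ≢ j → parity (k ∷ b ∷ c ∷ d ∷ l ∷ j ∷ []) j ≡ true
  odd-j c≢j d≢j
    rewrite dec-false (k ≟ j) (≢-sym j≢k) | dec-false (b ≟ j) b≢j | dec-false (c ≟ j) c≢j
          | dec-false (d ≟ j) d≢j | dec-false (l ≟ j) l≢j | dec-true (j ≟ j) ≡.refl = ≡.refl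
  choose : Dec (c ≡ k) → Dec (d ≡ k) → Dec (c ≡ l) → Dec (d ≡ l) →
           ∃[ x ] parity (k ∷ b ∷ c ∷ d ∷ l ∷ j ∷ []) x ≡ true
  choose (no c≢k)     (no d≢k)     _            _            = k , odd-k c≢k d≢k
  choose (yes ≡.refl) _            _            (no d≢l)     = l , odd-l (≢-sym l≢k) d≢l
  choose (yes ≡.refl) _            _            (yes ≡.refl) = j , odd-j (≢-sym j≢k) l≢j
  choose (no c≢k)     (yes ≡.refl) (no c≢l)     _            = l , odd-l c≢l (≢-sym l≢k)
  choose (no c≢k)     (yes ≡.refl) (yes ≡.refl) _            = j , odd-j l≢j (≢-sym j≢k)

record Avoiding {n} (m : ℕ) (j k : Fin n) : Set where
  field
    other           : Fin m → Fin n
    other-injective : ∀ {x y} → other x ≡ other y → x ≡ y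
    other≢j         : ∀ x → other x ≢ j
    other≢k         : ∀ x → other x ≢ k

avoiding : ∀ {m n} → 2 + m ≤ n → {j k : Fin n} → j ≢ k → Avoiding m j k
avoiding (s≤s (s≤s m≤n)) {j} {k} j≢k = record
  { other           = other
  ; other-injective = λ {x} {y} e →
      inject≤-injective m≤n m≤n x y (punchIn-injective _ _ _ (punchIn-injective j _ _ e))
  ; other≢j         = λ x → punchInᵢ≢i j _
  ; other≢k         = λ x e → punchInᵢ≢i (punchOut j≢k) _
      (punchIn-injective j _ _ (≡.trans e (≡.sym (punchIn-punchOut j≢k))))
  }
  where
  other : Fin _ → Fin _
  other x = punchIn j (punchIn (punchOut j≢k) (inject≤ x m≤n))

module Centre {c ℓ} (G : Group c ℓ) where
  open Group G renaming (Carrier to A)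
  open import Algebra.Properties.Group G using (∙-cancelˡ; ⁻¹-anti-homo-∙)
  open import Algebra.Properties.Monoid monoid using (cancelˡ)
  open import Relation.Binary.Reasoning.Setoid setoid

  central-ε : IsCentral G ε
  central-ε x = trans (identityˡ x) (sym (identityʳ x))

  central-∙ : ∀ {x y} → IsCentral G x → IsCentral G y → IsCentral G (x ∙ y)
  central-∙ {x} {y} x-central y-central a = begin
    (x ∙ y) ∙ a ≈⟨ assoc x y a ⟩
    x ∙ (y ∙ a) ≈⟨ ∙-congˡ (y-central a) ⟩
    x ∙ (a ∙ y) ≈⟨ assoc x a y ⟨
    (x ∙ a) ∙ y ≈⟨ ∙-congʳ (x-central a) ⟩
    (a ∙ x) ∙ y ≈⟨ assoc a x y ⟩
    a ∙ (x ∙ y) ∎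

  central-resp : ∀ {x y} → x ≈ y → IsCentral G x → IsCentral G y
  central-resp x≈y x-central a =
    trans (∙-congʳ (sym x≈y)) (trans (x-central a) (∙-congˡ x≈y))

  central-cancelˡ : ∀ {x y} → IsCentral G x → IsCentral G (x ∙ y) → IsCentral G y
  central-cancelˡ {x} {y} x-central xy-central a = ∙-cancelˡ x (y ∙ a) (a ∙ y) (begin
    x ∙ (y ∙ a) ≈⟨ assoc x y a ⟨
    (x ∙ y) ∙ a ≈⟨ xy-central a ⟩
    a ∙ (x ∙ y) ≈⟨ assoc a x y ⟨
    (a ∙ x) ∙ y ≈⟨ ∙-congʳ (x-central a) ⟨
    (x ∙ a) ∙ y ≈⟨ assoc x a y ⟩
    x ∙ (a ∙ y) ∎)

  ∙-swap-comm : ∀ x y → IsCentral G (comm G x y) → x ∙ y ≈ comm G x y ∙ (y ∙ x)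
  ∙-swap-comm x y comm-central = begin
    x ∙ y                                 ≈⟨ cancelˡ yx∙[yx]⁻¹≈ε (x ∙ y) ⟨
    (y ∙ x) ∙ ((x ⁻¹ ∙ y ⁻¹) ∙ (x ∙ y))  ≈⟨ ∙-congˡ (assoc (x ⁻¹ ∙ y ⁻¹) x y) ⟨
    (y ∙ x) ∙ comm G x y                  ≈⟨ comm-central (y ∙ x) ⟨
    comm G x y ∙ (y ∙ x)                  ∎
    where
    yx∙[yx]⁻¹≈ε : (y ∙ x) ∙ (x ⁻¹ ∙ y ⁻¹) ≈ ε
    yx∙[yx]⁻¹≈ε = trans (∙-congˡ (sym (⁻¹-anti-homo-∙ y x))) (inverseʳ (y ∙ x))

  infix 4 _≈ᶻ_
  _≈ᶻ_ : Rel A (c ⊔ ℓ)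
  x ≈ᶻ y = Σ[ z ∈ A ] IsCentral G z × x ≈ z ∙ y

  ≈⇒≈ᶻ : ∀ {x y} → x ≈ y → x ≈ᶻ y
  ≈⇒≈ᶻ {y = y} x≈y = ε , central-ε , trans x≈y (sym (identityˡ y))

  ≈ᶻ-trans : ∀ {x y w} → x ≈ᶻ y → y ≈ᶻ w → x ≈ᶻ w
  ≈ᶻ-trans {x} {y} {w} (z , z-central , x≈zy) (z′ , z′-central , y≈z′w) =
    z ∙ z′ , central-∙ z-central z′-central , (begin
      x             ≈⟨ x≈zy ⟩
      z ∙ y         ≈⟨ ∙-congˡ y≈z′w ⟩
      z ∙ (z′ ∙ w)  ≈⟨ assoc z z′ w ⟨
      (z ∙ z′) ∙ w  ∎)

  ≈ᶻ-preorder : Preorder c ℓ (c ⊔ ℓ)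
  ≈ᶻ-preorder = record
    { _≲_        = _≈ᶻ_
    ; isPreorder = record
      { isEquivalence = isEquivalence
      ; reflexive     = ≈⇒≈ᶻ
      ; trans         = ≈ᶻ-trans
      }
    }

  central-absorbˡ : ∀ {z} x → IsCentral G z → z ∙ x ≈ᶻ x
  central-absorbˡ {z} x z-central = z , z-central , refl

  ∙-congˡ-≈ᶻ : ∀ {x y} a → x ≈ᶻ y → a ∙ x ≈ᶻ a ∙ y
  ∙-congˡ-≈ᶻ {x} {y} a (z , z-central , x≈zy) = z , z-central , (begin
    a ∙ x        ≈⟨ ∙-congˡ x≈zy ⟩
    a ∙ (z ∙ y)  ≈⟨ assoc a z y ⟨
    (a ∙ z) ∙ y  ≈⟨ ∙-congʳ (z-central a) ⟨
    (z ∙ a) ∙ y  ≈⟨ assoc z a y ⟩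
    z ∙ (a ∙ y)  ∎)

  ∙-congʳ-≈ᶻ : ∀ {x y} a → x ≈ᶻ y → x ∙ a ≈ᶻ y ∙ a
  ∙-congʳ-≈ᶻ {x} {y} a (z , z-central , x≈zy) =
    z , z-central , trans (∙-congʳ x≈zy) (assoc z y a)

  ≈ᶻ-central : ∀ {x y} → x ≈ᶻ y → IsCentral G x → IsCentral G y
  ≈ᶻ-central (z , z-central , x≈zy) x-central =
    central-cancelˡ z-central (central-resp x≈zy x-central)

module Words {c ℓ} (G : Group c ℓ) where
  open Group G renaming (Carrier to A)

  word : ∀ {n} → (Fin n → A) → List (Fin n) → A
  word g = foldr (λ i x → g i ∙ x) ε

  word-++ : ∀ {n} (g : Fin n → A) u v → word g (u ++ v) ≈ word g u ∙ word g v
  word-++ g []      v = sym (identityˡ (word g v))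
  word-++ g (i ∷ u) v = trans (∙-congˡ (word-++ g u v)) (sym (assoc (g i) (word g u) (word g v)))

  word-map-suc : ∀ {n} (g : Fin (suc n) → A) w → word g (map suc w) ≡ word (g ∘ suc) w
  word-map-suc g = foldr-map _ suc ε

  prod-word : ∀ {n} (g : Fin n → A) T → ∃[ w ] prod G g T ≈ word g w
  prod-word {zero}  g T = [] , refl
  prod-word {suc n} g T with prod-word (g ∘ suc) (T ∘ suc) | T zero
  ... | w , P≈w | true  = zero ∷ map suc w , ∙-congˡ P≈sucw
    where P≈sucw = trans P≈w (reflexive (≡.sym (word-map-suc g w)))
  ... | w , P≈w | false = map suc w , trans (identityˡ _) P≈sucw
    where P≈sucw = trans P≈w (reflexive (≡.sym (word-map-suc g w)))

  prod-false : ∀ {n} (g : Fin n → A) → prod G g (λ _ → false) ≈ ε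
  prod-false {zero}  g = refl
  prod-false {suc n} g = trans (identityˡ _) (prod-false (g ∘ suc))

module CentralQuotient {c ℓ} (G : Group c ℓ)
    (square-central : ∀ x → IsCentral G (Group._∙_ G x x))
    (comm-central   : ∀ x y → IsCentral G (comm G x y)) where
  open Group G renaming (Carrier to A)
  open Centre G
  open Words G
  open import Relation.Binary.Reasoning.Preorder ≈ᶻ-preorder

  ∙-comm-≈ᶻ : ∀ x y → x ∙ y ≈ᶻ y ∙ x
  ∙-comm-≈ᶻ x y = comm G x y , comm-central x y , ∙-swap-comm x y (comm-central x y)

  toggle-prod : ∀ {n} (g : Fin n → A) i T → g i ∙ prod G g T ≈ᶻ prod G g (toggle i T)
  toggle-prod g zero T with T zero
  ... | true  = begin
    g zero ∙ (g zero ∙ P)  ≈⟨ assoc (g zero) (g zero) P ⟨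
    (g zero ∙ g zero) ∙ P  ≲⟨ central-absorbˡ P (square-central (g zero)) ⟩
    P                      ≈⟨ identityˡ P ⟨
    ε ∙ P                  ∎
    where P = prod G (g ∘ suc) (T ∘ suc)
  ... | false = ≈⇒≈ᶻ (∙-congˡ (identityˡ _))
  toggle-prod g (suc i) T with T zero
  ... | true  = begin
    g (suc i) ∙ (g zero ∙ P)  ≈⟨ assoc (g (suc i)) (g zero) P ⟨
    (g (suc i) ∙ g zero) ∙ P  ≲⟨ ∙-congʳ-≈ᶻ P (∙-comm-≈ᶻ (g (suc i)) (g zero)) ⟩
    (g zero ∙ g (suc i)) ∙ P  ≈⟨ assoc (g zero) (g (suc i)) P ⟩
    g zero ∙ (g (suc i) ∙ P)  ≲⟨ ∙-congˡ-≈ᶻ (g zero) (toggle-prod (g ∘ suc) i (T ∘ suc)) ⟩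
    g zero ∙ P′               ∎
    where P  = prod G (g ∘ suc) (T ∘ suc)
          P′ = prod G (g ∘ suc) (toggle i (T ∘ suc))
  ... | false = begin
    g (suc i) ∙ (ε ∙ P)  ≈⟨ ∙-congˡ (identityˡ P) ⟩
    g (suc i) ∙ P        ≲⟨ toggle-prod (g ∘ suc) i (T ∘ suc) ⟩
    P′                   ≈⟨ identityˡ P′ ⟨
    ε ∙ P′               ∎
    where P  = prod G (g ∘ suc) (T ∘ suc)
          P′ = prod G (g ∘ suc) (toggle i (T ∘ suc))

  word≈ᶻprod-parity : ∀ {n} (g : Fin n → A) w → word g w ≈ᶻ prod G g (parity w)
  word≈ᶻprod-parity g []      = ≈⇒≈ᶻ (sym (prod-false g))
  word≈ᶻprod-parity g (i ∷ w) = begin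
    g i ∙ word g w               ≲⟨ ∙-congˡ-≈ᶻ (g i) (word≈ᶻprod-parity g w) ⟩
    g i ∙ prod G g (parity w)    ≲⟨ toggle-prod g i (parity w) ⟩
    prod G g (parity (i ∷ w))    ∎

  central-word-even : ∀ {n} {g : Fin n → A} → IsBasisModCentre G g →
                      ∀ w → IsCentral G (word g w) → ∀ i → parity w i ≡ false
  central-word-even {g = g} basis w word-central =
    IsBasisModCentre.independent basis (parity w) (≈ᶻ-central (word≈ᶻprod-parity g w) word-central)

module CayleyGraph {c ℓ} (G : Group c ℓ) {n} (g : Fin n → Group.Carrier G) where
  open Group G renaming (Carrier to A)
  open import Algebra.Properties.Group G using (∙-cancelʳ)
  open import Algebra.Properties.Monoid monoid using (cancelˡ)
  open import Relation.Binary.Reasoning.Setoid setoid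

  record IsMonomorphism (f : A → A) : Set (c ⊔ ℓ) where
    field
      cong      : ∀ {x y} → x ≈ y → f x ≈ f y
      injective : ∀ {x y} → f x ≈ f y → x ≈ y
      edge      : ∀ i x → ∃[ j ] f (g i ∙ x) ≈ g j ∙ f x

  aut⇒monomorphism : (∀ i → g i ∙ g i ≈ ε) → (α : CayAut G g) → IsMonomorphism (CayAut.to α)
  aut⇒monomorphism involutive α = record
    { cong      = Bijection.cong (CayAut.perm α)
    ; injective = Bijection.injective (CayAut.perm α)
    ; edge      = edge
    }
    where
    f = CayAut.to α
    edge : ∀ i x → ∃[ j ] f (g i ∙ x) ≈ g j ∙ f x
    edge i x with Equivalence.to (CayAut.adj-pres α x (g i ∙ x)) (i , inj₁ refl)
    ... | j , inj₁ fgx≈gfx = j , fgx≈gfx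
    ... | j , inj₂ fx≈gfgx = j , sym (trans (∙-congˡ fx≈gfgx) (cancelˡ (involutive j) _))

  right-conjugate : ∀ {f} → IsMonomorphism f → ∀ v → IsMonomorphism (λ x → f (x ∙ v) ∙ v ⁻¹)
  right-conjugate {f} mono v = record
    { cong      = λ x≈y → ∙-congʳ (cong (∙-congʳ x≈y))
    ; injective = λ {x} {y} e → ∙-cancelʳ v x y (injective (∙-cancelʳ (v ⁻¹) _ _ e))
    ; edge      = edge′
    }
    where
    open IsMonomorphism mono
    edge′ : ∀ i x → ∃[ j ] f ((g i ∙ x) ∙ v) ∙ v ⁻¹ ≈ g j ∙ (f (x ∙ v) ∙ v ⁻¹)
    edge′ i x with edge i (x ∙ v)
    ... | j , e = j , (begin
      f ((g i ∙ x) ∙ v) ∙ v ⁻¹   ≈⟨ ∙-congʳ (cong (assoc (g i) x v)) ⟩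
      f (g i ∙ (x ∙ v)) ∙ v ⁻¹   ≈⟨ ∙-congʳ e ⟩
      (g j ∙ f (x ∙ v)) ∙ v ⁻¹   ≈⟨ assoc (g j) (f (x ∙ v)) (v ⁻¹) ⟩
      g j ∙ (f (x ∙ v) ∙ v ⁻¹)   ∎)

module _ {c ℓ} (G : Group c ℓ) where
  open Group G renaming (Carrier to A)
  open Words G

  record IsAnticommutingFamily (z : A) {n} (g : Fin n → A) : Set ℓ where
    field
      z-involutive   : z ∙ z ≈ ε
      involutive     : ∀ i → g i ∙ g i ≈ ε
      anticommute    : ∀ {i j} → i ≢ j → g i ∙ g j ≈ z ∙ (g j ∙ g i)
      relations-even : ∀ w → word g w ≈ ε → ∀ i → parity w i ≡ false

module Rigidity {c ℓ} {G : Group c ℓ} {z} {n} {g : Fin n → Group.Carrier G}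
                (family : IsAnticommutingFamily G z g) (5≤n : 5 ≤ n) where
  open Group G renaming (Carrier to A)
  open IsAnticommutingFamily family
  open Words G
  open CayleyGraph G g
  open import Algebra.Properties.Group G using (∙-cancelʳ)
  open import Algebra.Properties.Monoid monoid using (cancelˡ; cancelʳ)
  open import Relation.Binary.Reasoning.Setoid setoid

  odd⇒¬relation : ∀ w {x} → parity w x ≡ true → ¬ word g w ≈ ε
  odd⇒¬relation w {x} odd w≈ε =
    contradiction (≡.trans (≡.sym odd) (relations-even w w≈ε x)) λ ()

  relation⇒≡ : ∀ {a b} → g a ∙ g b ≈ ε → a ≡ b
  relation⇒≡ {a} {b} gagb≈ε with a ≟ b
  ... | yes a≡b = a≡b
  ... | no a≢b  = contradiction (trans (∙-congˡ (identityʳ (g b))) gagb≈ε) (odd⇒¬relation (a ∷ b ∷ []) odd)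
    where
    odd : parity (a ∷ b ∷ []) a ≡ true
    odd rewrite dec-true (a ≟ a) ≡.refl | dec-false (b ≟ a) (≢-sym a≢b) = ≡.refl

  g-injective : ∀ {a b} → g a ≈ g b → a ≡ b
  g-injective {a} {b} ga≈gb = relation⇒≡ (trans (∙-congʳ ga≈gb) (involutive b))

  no-hexagon : ∀ {j k l b c d} → j ≢ k → l ≢ j → l ≢ k → b ≢ j → b ≢ k → b ≢ l →
               ¬ g l ∙ g j ≈ g d ∙ (g c ∙ (g b ∙ g k))
  no-hexagon {j} {k} {l} {b} {c} {d} j≢k l≢j l≢k b≢j b≢k b≢l hexagon =
    odd⇒¬relation (k ∷ b ∷ c ∷ d ∷ l ∷ j ∷ []) (proj₂ (hexagon-odd {c = c} {d} j≢k l≢j l≢k b≢j b≢k b≢l)) (begin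
      g k ∙ (g b ∙ (g c ∙ (g d ∙ (g l ∙ (g j ∙ ε)))))
        ≈⟨ ∙-congˡ (∙-congˡ (∙-congˡ (∙-congˡ (trans (∙-congˡ (identityʳ (g j))) hexagon)))) ⟩
      g k ∙ (g b ∙ (g c ∙ (g d ∙ (g d ∙ (g c ∙ (g b ∙ g k))))))
        ≈⟨ ∙-congˡ (∙-congˡ (∙-congˡ (cancelˡ (involutive d) _))) ⟩
      g k ∙ (g b ∙ (g c ∙ (g c ∙ (g b ∙ g k))))
        ≈⟨ ∙-congˡ (∙-congˡ (cancelˡ (involutive c) _)) ⟩
      g k ∙ (g b ∙ (g b ∙ g k))
        ≈⟨ ∙-congˡ (cancelˡ (involutive b) _) ⟩
      g k ∙ g k
        ≈⟨ involutive k ⟩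
      ε ∎)

  detour : ∀ {a j k} → a ≢ j → a ≢ k → j ≢ k → g a ∙ (g j ∙ (g a ∙ g k)) ≈ g k ∙ g j
  detour {a} {j} {k} a≢j a≢k j≢k = begin
    g a ∙ (g j ∙ (g a ∙ g k))        ≈⟨ assoc (g a) (g j) (g a ∙ g k) ⟨
    (g a ∙ g j) ∙ (g a ∙ g k)        ≈⟨ ∙-congʳ (anticommute a≢j) ⟩
    (z ∙ (g j ∙ g a)) ∙ (g a ∙ g k)  ≈⟨ assoc z (g j ∙ g a) (g a ∙ g k) ⟩
    z ∙ ((g j ∙ g a) ∙ (g a ∙ g k))  ≈⟨ ∙-congˡ (assoc (g j) (g a) (g a ∙ g k)) ⟩
    z ∙ (g j ∙ (g a ∙ (g a ∙ g k)))  ≈⟨ ∙-congˡ (∙-congˡ (cancelˡ (involutive a) (g k))) ⟩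
    z ∙ (g j ∙ g k)                  ≈⟨ ∙-congˡ (anticommute j≢k) ⟩
    z ∙ (z ∙ (g k ∙ g j))            ≈⟨ cancelˡ z-involutive (g k ∙ g j) ⟩
    g k ∙ g j                        ∎

  module _ {f : A → A} (mono : IsMonomorphism f) (fixes-ε : f ε ≈ ε) (fixes-g : ∀ i → f (g i) ≈ g i) where
    open IsMonomorphism mono

    pair-image : ∀ k j → ∃[ l ] f (g k ∙ g j) ≈ g l ∙ g j
    pair-image k j with edge k (g j)
    ... | l , e = l , trans e (∙-congˡ (fixes-g j))

    pair-image-≢ : ∀ {a b c} → a ≢ b → f (g a ∙ g b) ≈ g c ∙ g b → c ≢ b
    pair-image-≢ a≢b fgagb≈gbgb ≡.refl =
      a≢b (relation⇒≡ (injective (trans fgagb≈gbgb (trans (involutive _) (sym fixes-ε)))))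

    detour-image : ∀ {a j k} → a ≢ j → a ≢ k → j ≢ k →
                   ∃₂ λ c d → f (g k ∙ g j) ≈ g d ∙ (g c ∙ f (g a ∙ g k))
    detour-image {a} {j} {k} a≢j a≢k j≢k with edge j (g a ∙ g k) | edge a (g j ∙ (g a ∙ g k))
    ... | c , e₁ | d , e₂ = c , d , (begin
      f (g k ∙ g j)                  ≈⟨ cong (detour a≢j a≢k j≢k) ⟨
      f (g a ∙ (g j ∙ (g a ∙ g k)))  ≈⟨ e₂ ⟩
      g d ∙ f (g j ∙ (g a ∙ g k))    ≈⟨ ∙-congˡ e₁ ⟩
      g d ∙ (g c ∙ f (g a ∙ g k))    ∎)

    second-image : ∀ {a j k l} → j ≢ k → f (g k ∙ g j) ≈ g l ∙ g j → l ≢ j → l ≢ k → a ≢ j → a ≢ k →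
                   f (g a ∙ g k) ≈ g l ∙ g k ⊎ f (g a ∙ g k) ≈ g j ∙ g k
    second-image {a} {j} {k} {l} j≢k fgkgj≈glgj l≢j l≢k a≢j a≢k
      with pair-image a k | detour-image a≢j a≢k j≢k
    ... | b , fgagk≈gbgk | c , d , fgkgj≈gdgcf = classify (b ≟ l) (b ≟ j)
      where
      classify : Dec (b ≡ l) → Dec (b ≡ j) → f (g a ∙ g k) ≈ g l ∙ g k ⊎ f (g a ∙ g k) ≈ g j ∙ g k
      classify (yes ≡.refl) _            = inj₁ fgagk≈gbgk
      classify (no _)       (yes ≡.refl) = inj₂ fgagk≈gbgk
      classify (no b≢l)     (no b≢j)     = contradiction hexagon
        (no-hexagon j≢k l≢j l≢k b≢j (pair-image-≢ a≢k fgagk≈gbgk) b≢l)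
        where
        hexagon : g l ∙ g j ≈ g d ∙ (g c ∙ (g b ∙ g k))
        hexagon = trans (sym fgkgj≈glgj) (trans fgkgj≈gdgcf (∙-congˡ (∙-congˡ fgagk≈gbgk)))

    fixes-pairs : ∀ k j → f (g k ∙ g j) ≈ g k ∙ g j
    fixes-pairs k j with k ≟ j
    ... | yes ≡.refl = trans (cong (involutive k)) (trans fixes-ε (sym (involutive k)))
    ... | no k≢j with pair-image k j
    ... | l , fgkgj≈glgj with l ≟ k
    ... | yes ≡.refl = fgkgj≈glgj
    ... | no l≢k = pigeonhole (side zero) (side (suc zero)) (side (suc (suc zero)))
      where
      j≢k = ≢-sym k≢j
      open Avoiding (avoiding 5≤n j≢k)
      Side : Fin 3 → Set ℓ
      Side x = f (g (other x) ∙ g k) ≈ g l ∙ g k ⊎ f (g (other x) ∙ g k) ≈ g j ∙ g k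
      side : ∀ x → Side x
      side x = second-image j≢k fgkgj≈glgj (pair-image-≢ k≢j fgkgj≈glgj) l≢k (other≢j x) (other≢k x)
      collide : ∀ {x y b} → f (g (other x) ∙ g k) ≈ g b ∙ g k → f (g (other y) ∙ g k) ≈ g b ∙ g k → x ≡ y
      collide ex ey = other-injective (g-injective (∙-cancelʳ (g k) _ _ (injective (trans ex (sym ey)))))
      pigeonhole : Side zero → Side (suc zero) → Side (suc (suc zero)) → f (g k ∙ g j) ≈ g k ∙ g j
      pigeonhole (inj₁ e₀) (inj₁ e₁) _         = contradiction (collide e₀ e₁) λ ()
      pigeonhole (inj₂ e₀) (inj₂ e₁) _         = contradiction (collide e₀ e₁) λ ()
      pigeonhole (inj₁ e₀) (inj₂ e₁) (inj₁ e₂) = contradiction (collide e₀ e₂) λ ()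
      pigeonhole (inj₁ e₀) (inj₂ e₁) (inj₂ e₂) = contradiction (collide e₁ e₂) λ ()
      pigeonhole (inj₂ e₀) (inj₁ e₁) (inj₁ e₂) = contradiction (collide e₁ e₂) λ ()
      pigeonhole (inj₂ e₀) (inj₁ e₁) (inj₂ e₂) = contradiction (collide e₀ e₂) λ ()

  fixes-pairs-around : ∀ {f v} → IsMonomorphism f → f v ≈ v → (∀ i → f (g i ∙ v) ≈ g i ∙ v) →
                       ∀ k j → f (g k ∙ (g j ∙ v)) ≈ g k ∙ (g j ∙ v)
  fixes-pairs-around {f} {v} mono fixes-v fixes-gv k j = begin
    f (g k ∙ (g j ∙ v))  ≈⟨ cong (assoc (g k) (g j) v) ⟨
    f ((g k ∙ g j) ∙ v)  ≈⟨ ∙-cancelʳ (v ⁻¹) _ _ translated ⟩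
    (g k ∙ g j) ∙ v      ≈⟨ assoc (g k) (g j) v ⟩
    g k ∙ (g j ∙ v)      ∎
    where
    open IsMonomorphism mono using (cong)
    translated : f ((g k ∙ g j) ∙ v) ∙ v ⁻¹ ≈ ((g k ∙ g j) ∙ v) ∙ v ⁻¹
    translated = trans
      (fixes-pairs (right-conjugate mono v)
        (trans (∙-congʳ (trans (cong (identityˡ v)) fixes-v)) (inverseʳ v))
        (λ i → trans (∙-congʳ (fixes-gv i)) (cancelʳ (inverseʳ v) (g i))) k j)
      (sym (cancelʳ (inverseʳ v) (g k ∙ g j)))

  fixes-words : ∀ {f} → IsMonomorphism f → f ε ≈ ε → (∀ i → f (g i) ≈ g i) →
                ∀ w → f (word g w) ≈ word g w × (∀ i → f (g i ∙ word g w) ≈ g i ∙ word g w)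
  fixes-words {f} mono fixes-ε fixes-g [] =
    fixes-ε , λ i → trans (cong (identityʳ (g i))) (trans (fixes-g i) (sym (identityʳ (g i))))
    where open IsMonomorphism mono using (cong)
  fixes-words mono fixes-ε fixes-g (j ∷ w) with fixes-words mono fixes-ε fixes-g w
  ... | fixes-w , fixes-gw = fixes-gw j , λ k → fixes-pairs-around mono fixes-w fixes-gw k j

  fixes-generated : ∀ {f} → IsMonomorphism f → f ε ≈ ε → (∀ i → f (g i) ≈ g i) →
                    (∀ x → ∃[ w ] x ≈ word g w) → ∀ x → f x ≈ x
  fixes-generated mono fixes-ε fixes-g generated x with generated x
  ... | w , x≈w =
    trans (cong x≈w) (trans (proj₁ (fixes-words mono fixes-ε fixes-g w)) (sym x≈w))
    where open IsMonomorphism mono using (cong)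

first-two : ∀ {n} → 2 ≤ n → Σ[ i ∈ Fin n ] Σ[ j ∈ Fin n ] i < j
first-two (s≤s (s≤s _)) = zero , suc zero , s≤s z≤n

module SymmetricBasis {c ℓ} {G : Group c ℓ} {r} (extraspecial : IsExtraspecial G r)
                      {n} {g : Fin n → Group.Carrier G} (symmetric : IsSymmetricBasis G g) where
  open Group G renaming (Carrier to A)
  open IsExtraspecial extraspecial
  open IsSymmetricBasis symmetric
  open Centre G
  open Words G
  open CentralQuotient G sq-central comm-central using (central-word-even)
  open import Algebra.Properties.Group G using (∙-cancelˡ; inverseʳ-unique)
  open import Algebra.Properties.Monoid monoid using (cancelˡ)
  open import Algebra.Properties.Semigroup semigroup using ([uv∙w]x≈u[v∙wx])
  open import Relation.Binary.Reasoning.Setoid setoid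

  z₀-involutive : z₀ ∙ z₀ ≈ ε
  z₀-involutive with centre⊆ (z₀ ∙ z₀) (sq-central z₀)
  ... | inj₁ z₀²≈ε  = z₀²≈ε
  ... | inj₂ z₀²≈z₀ =
    contradiction (∙-cancelˡ z₀ ε z₀ (trans (identityʳ z₀) (sym z₀²≈z₀))) (z₀≉ε ∘ sym)

  comm≈z₀ : ∀ {i j} → i < j → comm G (g i) (g j) ≈ z₀
  comm≈z₀ {i} {j} i<j with centre⊆ _ (comm-central (g i) (g j))
  ... | inj₁ comm≈ε  = contradiction comm≈ε (B-one i j i<j)
  ... | inj₂ comm≈z₀ = comm≈z₀

  anticommute< : ∀ {i j} → i < j → g i ∙ g j ≈ z₀ ∙ (g j ∙ g i)
  anticommute< {i} {j} i<j =
    trans (∙-swap-comm (g i) (g j) (comm-central (g i) (g j))) (∙-congʳ (comm≈z₀ i<j))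

  anticommute : ∀ {i j} → i ≢ j → g i ∙ g j ≈ z₀ ∙ (g j ∙ g i)
  anticommute {i} {j} i≢j with <-cmp i j
  ... | tri< i<j _ _ = anticommute< i<j
  ... | tri≈ _ i≡j _ = contradiction i≡j i≢j
  ... | tri> _ _ j<i = begin
    g i ∙ g j                ≈⟨ cancelˡ z₀-involutive (g i ∙ g j) ⟨
    z₀ ∙ (z₀ ∙ (g i ∙ g j))  ≈⟨ ∙-congˡ (anticommute< j<i) ⟨
    z₀ ∙ (g j ∙ g i)         ∎

  family : IsAnticommutingFamily G z₀ g
  family = record
    { z-involutive   = z₀-involutive
    ; involutive     = Q-zero
    ; anticommute    = anticommute
    ; relations-even = λ w w≈ε → central-word-even basis w (central-resp (sym w≈ε) central-ε)
    }

  z₀-word : ∀ {i j} → i < j → z₀ ≈ word g (i ∷ j ∷ i ∷ j ∷ [])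
  z₀-word {i} {j} i<j = begin
    z₀                                ≈⟨ comm≈z₀ i<j ⟨
    ((g i ⁻¹ ∙ g j ⁻¹) ∙ g i) ∙ g j   ≈⟨ ∙-congʳ (∙-congʳ (∙-cong (self-inverse i) (self-inverse j))) ⟨
    ((g i ∙ g j) ∙ g i) ∙ g j         ≈⟨ [uv∙w]x≈u[v∙wx] (g i) (g j) (g i) (g j) ⟩
    g i ∙ (g j ∙ (g i ∙ g j))         ≈⟨ ∙-congˡ (∙-congˡ (∙-congˡ (identityʳ (g j)))) ⟨
    word g (i ∷ j ∷ i ∷ j ∷ [])       ∎
    where
    self-inverse : ∀ k → g k ≈ g k ⁻¹
    self-inverse k = inverseʳ-unique (g k) (g k) (Q-zero k)

  generated : 2 ≤ n → ∀ x → ∃[ w ] x ≈ word g w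
  generated 2≤n x with first-two 2≤n | IsBasisModCentre.spanning basis x
  ... | i , j , i<j | T , z , z-central , x≈zP with prod-word g T | centre⊆ z z-central
  ... | w , P≈w | inj₁ z≈ε  = w , trans x≈zP (trans (∙-cong z≈ε P≈w) (identityˡ (word g w)))
  ... | w , P≈w | inj₂ z≈z₀ = (i ∷ j ∷ i ∷ j ∷ []) ++ w , (begin
    x                                        ≈⟨ x≈zP ⟩
    z ∙ prod G g T                           ≈⟨ ∙-cong (trans z≈z₀ (z₀-word i<j)) P≈w ⟩
    word g (i ∷ j ∷ i ∷ j ∷ []) ∙ word g w   ≈⟨ word-++ g (i ∷ j ∷ i ∷ j ∷ []) w ⟨
    word g ((i ∷ j ∷ i ∷ j ∷ []) ++ w)       ∎)

lemma4p5 : ∀ {c ℓ : Level} (r : ℕ) → 4 ≤ r → (G : Group c ℓ) → IsExtraspecial G r →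
             (g : Fin (2 * r) → Group.Carrier G) → IsSymmetricBasis G g →
             (α : CayAut G g) →
             Group._≈_ G (CayAut.to α (Group.ε G)) (Group.ε G) →
             (∀ i → Group._≈_ G (CayAut.to α (g i)) (g i)) →
             ∀ x → Group._≈_ G (CayAut.to α x) x
lemma4p5 r 4≤r G extraspecial g symmetric α fixes-ε fixes-g =
  fixes-generated (CayleyGraph.aut⇒monomorphism G g (IsSymmetricBasis.Q-zero symmetric) α)
    fixes-ε fixes-g (generated (≤-trans (s≤s (s≤s z≤n)) 5≤2r))
  where
  5≤2r : 5 ≤ 2 * r
  5≤2r = ≤-trans (s≤s (s≤s (s≤s (s≤s (s≤s z≤n))))) (*-monoʳ-≤ 2 4≤r)
  open SymmetricBasis extraspecial symmetric using (family; generated)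
  open Rigidity family 5≤2r using (fixes-generated)
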